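{- Let $\mathbf{q}=(q_1,\dots,q_a)$ be an element of $\prod_{j=1}^a L(v_1,x_j)$ and let $s=s(\mathbf{q})$. Then \[ |\mathcal{C}_{X,\mathbf{q}}| \ge a^{a-s}(n+a-1)^s\prod_{i=2}^{n-1}(n+a-i)^a. \]
   Context: Standing setting: $n,a$ are integers with $2\le n\le a$; $M=K_n$ with $V(M)=\{v_1,\dots,v_n\}$; $K_{a,b}$ has partite sets $X=\{x_1,\dots,x_a\}$ and $Y=\{y_1,\dots,y_b\}$ with $b=\left(\prod_{i=0}^{n-1}(n+a-1-i)\right)^a-1$; $H=M\square K_{a,b}$ (Cartesian product). $L$ is an $(n+a-1)$-assignment for $H$ such that for each $i\in[n]$ the lists $L(v_i,x_1),\dots,L(v_i,x_a)$ are pairwise disjoint. $H_X$ is the subgraph of $H$ induced by $\{(v_i,x_j): i\in[n],j\in[a]\}$ (so $(v_i,x_j)\sim(v_{i'},x_{j'})$ in $H_X$ iff $j=j'$ and $i\ne i'$), $L_X$ is the restriction of $L$ to $V(H_X)$, and $\mathcal{C}_X$ is the set of all proper $L_X$-colorings of $H_X$. For each color $q\in\bigcup_{j=1}^a L(v_1,x_j)$, $s_q=1$ if there exists $c\in\mathcal{C}_X$ with $|c^{ -1}(q)|=n$, and $s_q=0$ otherwise. For $\mathbf{q}=(q_1,\dots,q_a)\in\prod_{j=1}^a L(v_1,x_j)$, $s(\mathbf{q})=\sum_{j=1}^a s_{q_j}$, and $\mathcal{C}_{X,\mathbf{q}}$ is the set of $c\in\mathcal{C}_X$ with $c(v_1,x_j)=q_j$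 for all $j\in[a]$. -}

module Defs where

open import Data.Nat using (ℕ; zero; suc; _+_; _*_; _∸_; _^_; _≤_; _<_; z≤n; s≤s)
open import Data.Nat.Properties using (_≟_; ≤-trans)
open import Data.Fin using (Fin; fromℕ<)
open import Data.Sum using (_⊎_; inj₁; inj₂)
open import Data.Product using (Σ; ∃; _×_; _,_)
open import Data.List using (List; length; map; upTo; allFin)
open import Data.Nat.ListAction using (sum; product)
open import Data.List.Membership.Propositional using (_∈_; _∉_)
open import Data.List.Relation.Unary.Unique.Propositional using (Unique)
open import Data.Bool using (if_then_else_)
open import Relation.Nullary using (¬_)
open import Relation.Nullary.Decidable using (⌊_⌋)
open import Relation.Binary.PropositionalEquality using (_≡_; _≢_)

sumFin : (m : ℕ) → (Fin m → ℕ) → ℕ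
sumFin m f = sum (map f (allFin m))

bVal : ℕ → ℕ → ℕ
bVal n a = (product (map (λ i → n + a ∸ 1 ∸ i) (upTo n))) ^ a ∸ 1

-- ∏_{i=2}^{n-1} (n+a-i)^a   (index i = k + 2, k = 0 .. n-3)
prodTail : ℕ → ℕ → ℕ
prodTail n a = product (map (λ k → (n + a ∸ (k + 2)) ^ a) (upTo (n ∸ 2)))

-- the vertex v₁ (index 0) of K_n
v₁ : ∀ {n} → 2 ≤ n → Fin n
v₁ h = fromℕ< (≤-trans (s≤s z≤n) h)

-- A list assignment for H = K_n □ K_{a,b}: vertex (v_i, x_j) ↦ L i (inj₁ j),
-- vertex (v_i, y_k) ↦ L i (inj₂ k).  Colors are natural numbers.
Assignment : ℕ → ℕ → ℕ → Set
Assignment n a b = Fin n → Fin a ⊎ Fin b → List ℕ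

IsKAssignment : ∀ {n a b} → ℕ → Assignment n a b → Set
IsKAssignment {n} {a} {b} k L = ∀ (i : Fin n) (v : Fin a ⊎ Fin b) → length (L i v) ≡ k × Unique (L i v)

XDisjoint : ∀ {n a b} → Assignment n a b → Set
XDisjoint {n} {a} L = ∀ (i : Fin n) (j j' : Fin a) → j ≢ j' → ∀ col → col ∈ L i (inj₁ j) → col ∉ L i (inj₁ j')

-- colorings of H_X : c i j is the color of (v_i, x_j)
XColoring : ℕ → ℕ → Set
XColoring n a = Fin n → Fin a → ℕ

ProperLX : ∀ {n a b} → Assignment n a b → XColoring n a → Set
ProperLX {n} {a} L c =
  (∀ (i : Fin n) (j : Fin a) → c i j ∈ L i (inj₁ j)) ×
  (∀ (i i' : Fin n) (j : Fin a) → i ≢ i' → c i j ≢ c i' j)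

preimageSize : ∀ {n a} → XColoring n a → ℕ → ℕ
preimageSize {n} {a} c q = sumFin n (λ i → sumFin a (λ j → if ⌊ c i j ≟ q ⌋ then 1 else 0))

SColor : ∀ {n a b} → Assignment n a b → ℕ → Set
SColor {n} {a} L q = Σ (XColoring n a) (λ c → ProperLX L c × preimageSize c q ≡ n)

IsSValue : ∀ {n a b} → Assignment n a b → ℕ → ℕ → Set
IsSValue L q σ = (SColor L q × σ ≡ 1) ⊎ (¬ SColor L q × σ ≡ 0)

InCXq : ∀ {n a b} → Assignment n a b → Fin n → (Fin a → ℕ) → XColoring n a → Set
InCXq {n} {a} L v q c = ProperLX L c × (∀ (j : Fin a) → c v j ≡ q j)

AtLeast : ∀ {n a} → ℕ → (XColoring n a → Set) → Set
AtLeast {n} {a} N P =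
  Σ (Fin N → XColoring n a) (λ f →
    (∀ k → P (f k)) ×
    (∀ k k' → (∀ (i : Fin n) (j : Fin a) → f k i j ≡ f k' i j) → k ≡ k'))

{-# OPTIONS --safe #-}
module Submission where

-- H_X is the disjoint union of the a cliques {(v_i, x_j) : i ∈ [n]}, one for each x_j,
-- so a coloring in 𝒞_{X,q} is a tuple of independent colorings of these columns with (v_1, x_j)
-- precolored q_j.  Coloring v_2, …, v_n greedily from lists of size n+a-1 while avoiding q_j leaves
-- (n+a-2)(n+a-3)⋯a choices.  If s_{q_j} = 1, some proper coloring uses q_j in every row; as the lists
-- of a row are disjoint, q_j can then only sit at (v_i, x_j) in each row i with q_j ∈ L(v_i, x_j), so
-- properness forces q_j ∉ L(v_i, x_j) for i ≥ 2.  Then nothing has to be avoided and the greedy count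
-- improves to (n+a-1)(n+a-2)⋯(a+1).

open import Defs
open import Algebra.Properties.CommutativeSemigroup using (x∙yz≈y∙xz)
open import Data.Bool using (if_then_else_)
open import Data.Empty using (⊥-elim)
open import Data.Fin using (Fin; zero; suc; inject≤; remQuot; combine; punchIn)
import Data.Fin.Properties as Fin
open import Data.Fin.Properties using (inject≤-injective; combine-remQuot; any?; punchIn-injective; punchInᵢ≢i)
open import Data.List using (List; []; _∷_; [_]; _++_; length; lookup; map; tabulate; upTo)
open import Data.List.Membership.Propositional using (_∈_; _∉_)
open import Data.List.Membership.Propositional.Properties using (∈-lookup)
open import Data.List.Properties using (map-++; map-∘; map-cong; map-tabulate; tabulate-cong; upTo-∷ʳ)
import Data.List.Relation.Unary.All as All
open import Data.List.Relation.Unary.AllPairs using (_∷_)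
open import Data.List.Relation.Unary.Any using (here; there)
open import Data.List.Relation.Unary.Unique.Propositional using (Unique)
import Data.Nat as ℕ
open import Data.Nat using (ℕ; zero; suc; pred; _+_; _*_; _∸_; _^_; _≤_; _<_; z≤n; s≤s)
open import Data.Nat.Combinatorics.Base using (_P′_)
open import Data.Nat.ListAction using (sum; product)
open import Data.Nat.ListAction.Properties using (product-++)
open import Data.Nat.Properties
  using ( ≤-refl; ≤-reflexive; <-irrefl; +-comm; +-mono-≤; +-mono-≤-<; *-comm; *-identityˡ; *-identityʳ
        ; *-commutativeSemigroup; [m*n]*[o*p]≡[m*o]*[n*p]; ^-zeroˡ; ^-distribˡ-+-*
        ; 0∸n≡0; pred[m∸n]≡m∸[1+n]; ∸-monoˡ-≤; +-∸-assoc; m+n∸m≡n )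
open import Data.Product using (Σ; _×_; _,_; proj₁; proj₂; uncurry)
open import Data.Product.Relation.Binary.Pointwise.NonDependent using () renaming (Pointwise to ×-Pointwise)
open import Data.Sum using (inj₁; inj₂)
import Data.Vec.Functional as V
open import Data.Vec.Functional.Relation.Binary.Pointwise using (Pointwise)
open import Function using (_∘_; id)
open import Function.Definitions using (Injective)
open import Level using (0ℓ)
open import Relation.Binary using (Rel; DecidableEquality)
open import Relation.Binary.PropositionalEquality hiding ([_])
open import Relation.Nullary using (yes; no)
open import Relation.Nullary.Decidable using (⌊_⌋; decidable-stable)
open import Relation.Unary using (Pred)

-- Counting by distinct witnesses

-- |{x | P x}| ≥ N, counted up to _≈_ (colorings are functions, so they are compared pointwise).
record Witnesses {A : Set} (_≈_ : Rel A 0ℓ) (P : Pred A 0ℓ) (N : ℕ) : Set where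
  field
    pick     : Fin N → A
    valid    : ∀ k → P (pick k)
    distinct : ∀ {k k′} → pick k ≈ pick k′ → k ≡ k′

open Witnesses

private
  variable
    A B : Set
    M N : ℕ
    _≈_ : Rel A 0ℓ
    P : Pred A 0ℓ

witnesses-≤ : M ≤ N → Witnesses _≈_ P N → Witnesses _≈_ P M
witnesses-≤ {M = M} {N = N} M≤N W = record
  { pick     = pick W ∘ inj
  ; valid    = valid W ∘ inj
  ; distinct = inject≤-injective M≤N M≤N _ _ ∘ distinct W
  }
  where
  inj : Fin M → Fin N
  inj k = inject≤ k M≤N

witnesses-map : {_≈′_ : Rel B 0ℓ} {Q : Pred B 0ℓ} (f : A → B) →
  (∀ {x} → P x → Q (f x)) → (∀ {x y} → f x ≈′ f y → x ≈ y) →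
  Witnesses _≈_ P N → Witnesses _≈′_ Q N
witnesses-map f P⇒Q reflects W = record
  { pick     = f ∘ pick W
  ; valid    = P⇒Q ∘ valid W
  ; distinct = distinct W ∘ reflects
  }

remQuot-injective : ∀ {m} n {i j : Fin (m * n)} → remQuot {m} n i ≡ remQuot n j → i ≡ j
remQuot-injective {m} n {i} {j} eq = begin
  i                                   ≡⟨ combine-remQuot {m} n i ⟨
  uncurry combine (remQuot {m} n i) ≡⟨ cong (uncurry combine) eq ⟩
  uncurry combine (remQuot {m} n j) ≡⟨ combine-remQuot {m} n j ⟩
  j                                   ∎
  where open ≡-Reasoning

witnesses-Σ : {_≈′_ : Rel B 0ℓ} {Q : A → Pred B 0ℓ} →
  Witnesses _≈_ P M → (∀ {x} → P x → Witnesses _≈′_ (Q x) N) →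
  Witnesses (×-Pointwise _≈_ _≈′_) (λ (x , y) → P x × Q x y) (M * N)
witnesses-Σ {_≈_ = _≈_} {M = M} {N = N} {_≈′_ = _≈′_} W V = record
  { pick     = λ t → let (k , l) = remQuot N t in pick W k , pick (fibre k) l
  ; valid    = λ t → let (k , l) = remQuot N t in valid W k , valid (fibre k) l
  ; distinct = λ (e , e′) → let k≡k′ = distinct W e in
      remQuot-injective N (cong₂ _,_ k≡k′ (fibre-distinct k≡k′ e′))
  }
  where
  fibre : ∀ k → Witnesses _≈′_ _ N
  fibre k = V (valid W k)
  fibre-distinct : ∀ {k k′ l l′} → k ≡ k′ → pick (fibre k) l ≈′ pick (fibre k′) l′ → l ≡ l′
  fibre-distinct refl = distinct (fibre _)

witnesses-Π : ∀ {k} {_≈_ : Rel B 0ℓ} {P : Fin k → Pred B 0ℓ} {N : Fin k → ℕ} →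
  (∀ j → Witnesses _≈_ (P j) (N j)) →
  Witnesses (Pointwise _≈_) (λ f → ∀ j → P j (f j)) (product (tabulate N))
witnesses-Π {k = zero} _ = record
  { pick = λ _ (); valid = λ _ (); distinct = λ { {zero} {zero} _ → refl } }
witnesses-Π {k = suc k} W =
  witnesses-map (uncurry V._∷_)
    (λ (p , ps) → λ { zero → p ; (suc j) → ps j })
    (λ e → e zero , e ∘ suc)
    (witnesses-Σ (W zero) (λ _ → witnesses-Π (W ∘ suc)))

lookup-injective : ∀ {xs : List A} → Unique xs → ∀ {i j} → lookup xs i ≡ lookup xs j → i ≡ j
lookup-injective {xs = _ ∷ _} _             {zero}  {zero}  _ = refl
lookup-injective {xs = _ ∷ _} (x∉xs ∷ _)    {zero}  {suc j} e = ⊥-elim (All.lookup x∉xs (∈-lookup j) e)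
lookup-injective {xs = _ ∷ _} (x∉xs ∷ _)    {suc i} {zero}  e = ⊥-elim (All.lookup x∉xs (∈-lookup i) (sym e))
lookup-injective {xs = _ ∷ _} (_ ∷ unique) {suc i} {suc j} e = cong suc (lookup-injective unique e)

witnesses-∈ : {xs : List A} → Unique xs → Witnesses _≡_ (_∈ xs) (length xs)
witnesses-∈ {xs = xs} unique = record
  { pick = lookup xs ; valid = ∈-lookup ; distinct = lookup-injective unique }

witnesses-≢ : DecidableEquality A → (y : A) → Witnesses _≡_ P N → Witnesses _≡_ (λ x → P x × x ≢ y) (pred N)
witnesses-≢ {N = zero}  _   _ W = record { pick = λ () ; valid = λ () ; distinct = λ { {()} } }
witnesses-≢ {N = suc N} _≟_ y W = record
  { pick     = pick W ∘ punchIn hole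
  ; valid    = λ k → valid W _ , punchInᵢ≢i hole k ∘ only-hole
  ; distinct = punchIn-injective hole _ _ ∘ distinct W
  }
  where
  -- Punch out the only index, if any, at which W picks y.
  hole-spec : Σ (Fin (suc N)) λ h → ∀ {k} → pick W k ≡ y → k ≡ h
  hole-spec with any? (λ k → pick W k ≟ y)
  ... | yes (h , e) = h , λ e′ → distinct W (trans e′ (sym e))
  ... | no none     = zero , λ e′ → ⊥-elim (none (_ , e′))
  hole : Fin (suc N)
  hole = proj₁ hole-spec
  only-hole : ∀ {k} → pick W k ≡ y → k ≡ hole
  only-hole = proj₂ hole-spec

witnesses-∉ : DecidableEquality A → (F : List A) → Witnesses _≡_ P N → Witnesses _≡_ (λ x → P x × x ∉ F) (N ∸ length F)
witnesses-∉ _ [] W = witnesses-map id (_, λ ()) id W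
witnesses-∉ {N = N} _≟_ (y ∷ F) W =
  subst (Witnesses _ _) (pred[m∸n]≡m∸[1+n] N (length F))
    (witnesses-map id (λ ((p , ∉F) , ≢y) → p , λ { (here e) → ≢y e ; (there x∈F) → ∉F x∈F }) id
      (witnesses-≢ _≟_ y (witnesses-∉ _≟_ F W)))

-- Falling factorials, sums and products

-- n P′ k = n (n - 1) ⋯ (n - k + 1): its defining equation splits off the smallest factor, P′-suc the largest.
P′-suc : ∀ n k → n P′ suc k ≡ n * (pred n P′ k)
P′-suc zero    k       = cong (_* (0 P′ k)) (0∸n≡0 k)
P′-suc (suc n) zero    = refl
P′-suc (suc n) (suc k) = begin
  (n ∸ k) * (suc n P′ suc k)   ≡⟨ cong ((n ∸ k) *_) (P′-suc (suc n) k) ⟩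
  (n ∸ k) * (suc n * (n P′ k))  ≡⟨ x∙yz≈y∙xz *-commutativeSemigroup (n ∸ k) (suc n) (n P′ k) ⟩
  suc n * ((n ∸ k) * (n P′ k))  ∎
  where open ≡-Reasoning

product-upTo-∸ : ∀ x k → product (map (x ∸_) (upTo k)) ≡ x P′ k
product-upTo-∸ x zero    = refl
product-upTo-∸ x (suc k) = begin
  product (map (x ∸_) (upTo (suc k)))              ≡⟨ cong (product ∘ map (x ∸_)) (upTo-∷ʳ k) ⟨
  product (map (x ∸_) (upTo k ++ [ k ]))           ≡⟨ cong product (map-++ (x ∸_) (upTo k) [ k ]) ⟩
  product (map (x ∸_) (upTo k) ++ [ x ∸ k ])       ≡⟨ product-++ (map (x ∸_) (upTo k)) [ x ∸ k ] ⟩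
  product (map (x ∸_) (upTo k)) * ((x ∸ k) * 1)    ≡⟨ cong₂ _*_ (product-upTo-∸ x k) (*-identityʳ (x ∸ k)) ⟩
  (x P′ k) * (x ∸ k)                               ≡⟨ *-comm (x P′ k) (x ∸ k) ⟩
  (x ∸ k) * (x P′ k)                               ∎
  where open ≡-Reasoning

^-distribʳ-* : ∀ m n o → (m * n) ^ o ≡ m ^ o * n ^ o
^-distribʳ-* m n zero    = refl
^-distribʳ-* m n (suc o) = begin
  m * n * (m * n) ^ o      ≡⟨ cong (m * n *_) (^-distribʳ-* m n o) ⟩
  m * n * (m ^ o * n ^ o)  ≡⟨ [m*n]*[o*p]≡[m*o]*[n*p] m n (m ^ o) (n ^ o) ⟩
  m * m ^ o * (n * n ^ o)  ∎
  where open ≡-Reasoning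

product-map-^ : ∀ e xs → product (map (_^ e) xs) ≡ product xs ^ e
product-map-^ e []       = sym (^-zeroˡ e)
product-map-^ e (x ∷ xs) = begin
  x ^ e * product (map (_^ e) xs)  ≡⟨ cong (x ^ e *_) (product-map-^ e xs) ⟩
  x ^ e * product xs ^ e           ≡⟨ ^-distribʳ-* x (product xs) e ⟨
  (x * product xs) ^ e             ∎
  where open ≡-Reasoning

sumFin≡sum-tabulate : ∀ k (f : Fin k → ℕ) → sumFin k f ≡ sum (tabulate f)
sumFin≡sum-tabulate k f = cong sum (map-tabulate id f)

sum-tabulate-≤ : ∀ {k} {e : Fin k → ℕ} → (∀ j → e j ≤ 1) → sum (tabulate e) ≤ k
sum-tabulate-≤ {zero}  _  = z≤n
sum-tabulate-≤ {suc k} e≤1 = +-mono-≤ (e≤1 zero) (sum-tabulate-≤ (e≤1 ∘ suc))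

sum-tabulate-< : ∀ {k} {e : Fin k → ℕ} → (∀ j → e j ≤ 1) → ∀ j₀ → e j₀ ≡ 0 → sum (tabulate e) < k
sum-tabulate-< {suc k} e≤1 zero    e₀≡0 = +-mono-≤-< (≤-reflexive e₀≡0) (s≤s (sum-tabulate-≤ (e≤1 ∘ suc)))
sum-tabulate-< {suc k} e≤1 (suc j) eⱼ≡0 = +-mono-≤-< (e≤1 zero) (sum-tabulate-< (e≤1 ∘ suc) j eⱼ≡0)

sum-tabulate-1∸ : ∀ {k} {e : Fin k → ℕ} → (∀ j → e j ≤ 1) →
  sum (tabulate (λ j → 1 ∸ e j)) ≡ k ∸ sum (tabulate e)
sum-tabulate-1∸ {zero}          _   = refl
sum-tabulate-1∸ {suc k} {e = e} e≤1
  rewrite sum-tabulate-1∸ (e≤1 ∘ suc) with e zero | e≤1 zero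
... | zero     | _       = sym (+-∸-assoc 1 (sum-tabulate-≤ (e≤1 ∘ suc)))
... | suc zero | _       = refl
... | suc (suc _) | s≤s ()

product-tabulate-* : ∀ {k} (f g : Fin k → ℕ) →
  product (tabulate (λ j → f j * g j)) ≡ product (tabulate f) * product (tabulate g)
product-tabulate-* {zero}  f g = refl
product-tabulate-* {suc k} f g = begin
  f zero * g zero * product (tabulate (λ j → f (suc j) * g (suc j)))
    ≡⟨ cong (f zero * g zero *_) (product-tabulate-* (f ∘ suc) (g ∘ suc)) ⟩
  f zero * g zero * (product (tabulate (f ∘ suc)) * product (tabulate (g ∘ suc)))
    ≡⟨ [m*n]*[o*p]≡[m*o]*[n*p] (f zero) (g zero) _ _ ⟩
  f zero * product (tabulate (f ∘ suc)) * (g zero * product (tabulate (g ∘ suc)))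
    ∎
  where open ≡-Reasoning

product-tabulate-^ : ∀ {k} x (e : Fin k → ℕ) → product (tabulate (λ j → x ^ e j)) ≡ x ^ sum (tabulate e)
product-tabulate-^ {zero}  x e = refl
product-tabulate-^ {suc k} x e = begin
  x ^ e zero * product (tabulate (λ j → x ^ e (suc j)))  ≡⟨ cong (x ^ e zero *_) (product-tabulate-^ x (e ∘ suc)) ⟩
  x ^ e zero * x ^ sum (tabulate (e ∘ suc))              ≡⟨ ^-distribˡ-+-* x (e zero) _ ⟨
  x ^ (e zero + sum (tabulate (e ∘ suc)))                ∎
  where open ≡-Reasoning

product-tabulate-const : ∀ k x → product (tabulate {n = k} (λ _ → x)) ≡ x ^ k
product-tabulate-const zero    x = refl
product-tabulate-const (suc k) x = cong (x *_) (product-tabulate-const k x)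

product-tabulate-powers : ∀ {k} x y z {e : Fin k → ℕ} → (∀ j → e j ≤ 1) →
  product (tabulate (λ j → x ^ (1 ∸ e j) * y ^ e j * z))
    ≡ x ^ (k ∸ sum (tabulate e)) * y ^ sum (tabulate e) * z ^ k
product-tabulate-powers {k} x y z {e} e≤1 = begin
  product (tabulate (λ j → x ^ (1 ∸ e j) * y ^ e j * z))
    ≡⟨ product-tabulate-* (λ j → x ^ (1 ∸ e j) * y ^ e j) (λ _ → z) ⟩
  product (tabulate (λ j → x ^ (1 ∸ e j) * y ^ e j)) * product (tabulate {n = k} (λ _ → z))
    ≡⟨ cong₂ _*_ (product-tabulate-* (λ j → x ^ (1 ∸ e j)) (λ j → y ^ e j)) (product-tabulate-const k z) ⟩
  product (tabulate (λ j → x ^ (1 ∸ e j))) * product (tabulate (λ j → y ^ e j)) * z ^ k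
    ≡⟨ cong (λ t → t * product (tabulate (λ j → y ^ e j)) * z ^ k) (product-tabulate-^ x (λ j → 1 ∸ e j)) ⟩
  x ^ sum (tabulate (λ j → 1 ∸ e j)) * product (tabulate (λ j → y ^ e j)) * z ^ k
    ≡⟨ cong₂ (λ s t → x ^ s * t * z ^ k) (sum-tabulate-1∸ e≤1) (product-tabulate-^ y e) ⟩
  x ^ (k ∸ sum (tabulate e)) * y ^ sum (tabulate e) * z ^ k
    ∎
  where open ≡-Reasoning

-- Greedy list colorings of a clique

record CliqueColoring {k} (Ls : Fin k → List ℕ) (F : List ℕ) (c : Fin k → ℕ) : Set where
  field
    ∈-lists     : ∀ i → c i ∈ Ls i
    ∉-forbidden : ∀ i → c i ∉ F
    injective   : Injective _≡_ _≡_ c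

open CliqueColoring

∷-cliqueColoring : ∀ {k} {Ls : Fin (suc k) → List ℕ} {F x c} → x ∈ Ls zero → x ∉ F →
  CliqueColoring (V.tail Ls) (x ∷ F) c → CliqueColoring Ls F (x V.∷ c)
∷-cliqueColoring x∈L x∉F χ = record
  { ∈-lists     = λ { zero → x∈L ; (suc i) → ∈-lists χ i }
  ; ∉-forbidden = λ { zero → x∉F ; (suc i) → ∉-forbidden χ i ∘ there }
  ; injective   = λ
      { {zero}  {zero}  _ → refl
      ; {zero}  {suc j} e → ⊥-elim (∉-forbidden χ j (here (sym e)))
      ; {suc i} {zero}  e → ⊥-elim (∉-forbidden χ i (here e))
      ; {suc i} {suc j} e → cong suc (injective χ e)
      }
  }

cliqueColoring-∉-lists : ∀ {k} {Ls : Fin k → List ℕ} {F x c} → (∀ i → x ∉ Ls i) →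
  CliqueColoring Ls F c → CliqueColoring Ls (x ∷ F) c
cliqueColoring-∉-lists x∉L χ = record
  { ∈-lists     = ∈-lists χ
  ; ∉-forbidden = λ { i (here e) → x∉L i (subst (_∈ _) e (∈-lists χ i)) ; i (there c∈F) → ∉-forbidden χ i c∈F }
  ; injective   = injective χ
  }

cliqueColorings : ∀ {k ℓ} (Ls : Fin k → List ℕ) → (∀ i → ℓ ≤ length (Ls i)) → (∀ i → Unique (Ls i)) →
  ∀ F → Witnesses (Pointwise _≡_) (CliqueColoring Ls F) ((ℓ ∸ length F) P′ k)
cliqueColorings {zero} _ _ _ _ = record
  { pick     = λ _ ()
  ; valid    = λ _ → record { ∈-lists = λ () ; ∉-forbidden = λ () ; injective = λ { {()} } }
  ; distinct = λ { {zero} {zero} _ → refl }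
  }
cliqueColorings {suc k} {ℓ} Ls long unique F =
  subst (Witnesses _ _) count
    (witnesses-map (uncurry V._∷_) (λ ((x∈L , x∉F) , χ) → ∷-cliqueColoring x∈L x∉F χ) (λ e → e zero , e ∘ suc)
      (witnesses-Σ first (λ {x} _ → cliqueColorings (V.tail Ls) (long ∘ suc) (unique ∘ suc) (x ∷ F))))
  where
  first : Witnesses _≡_ (λ x → x ∈ Ls zero × x ∉ F) (ℓ ∸ length F)
  first = witnesses-≤ (∸-monoˡ-≤ (length F) (long zero)) (witnesses-∉ ℕ._≟_ F (witnesses-∈ (unique zero)))
  count : (ℓ ∸ length F) * ((ℓ ∸ suc (length F)) P′ k) ≡ (ℓ ∸ length F) P′ suc k
  count = begin
    (ℓ ∸ length F) * ((ℓ ∸ suc (length F)) P′ k) ≡⟨ cong (λ t → (ℓ ∸ length F) * (t P′ k)) (pred[m∸n]≡m∸[1+n] ℓ (length F)) ⟨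
    (ℓ ∸ length F) * (pred (ℓ ∸ length F) P′ k)  ≡⟨ P′-suc (ℓ ∸ length F) k ⟨
    (ℓ ∸ length F) P′ suc k                      ∎
    where open ≡-Reasoning

-- Saturated colors and the columns of H_X

count≡ : ∀ {k} → (Fin k → ℕ) → ℕ → ℕ
count≡ d q = sum (tabulate (λ j → if ⌊ d j ℕ.≟ q ⌋ then 1 else 0))

count≡-none : ∀ {k} {d : Fin k → ℕ} {q} → (∀ {j} → d j ≢ q) → count≡ d q ≡ 0
count≡-none {zero}          _   = refl
count≡-none {suc k} {d} {q} d≢q with d zero ℕ.≟ q
... | yes e = ⊥-elim (d≢q e)
... | no  _ = count≡-none {d = d ∘ suc} d≢q

count≡-≤1 : ∀ {k} {d : Fin k → ℕ} {q} → (∀ {j j′} → d j ≡ q → d j′ ≡ q → j ≡ j′) → count≡ d q ≤ 1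
count≡-≤1 {zero}          _    = z≤n
count≡-≤1 {suc k} {d} {q} once with d zero ℕ.≟ q
... | yes e = ≤-reflexive (cong suc (count≡-none {d = d ∘ suc} (Fin.0≢1+n ∘ once e)))
... | no  _ = count≡-≤1 {d = d ∘ suc} (λ e e′ → Fin.suc-injective (once e e′))

preimageSize≡ : ∀ {n a} (c : XColoring n a) q → preimageSize c q ≡ sum (tabulate (λ i → count≡ (c i) q))
preimageSize≡ {n} {a} c q =
  trans (sumFin≡sum-tabulate n _) (cong sum (tabulate-cong (λ i → sumFin≡sum-tabulate a (λ j → if ⌊ c i j ℕ.≟ q ⌋ then 1 else 0))))

SColor⇒∉ : ∀ {n a b} {L : Assignment n a b} → XDisjoint L → ∀ {q v i j} →
  SColor L q → q ∈ L v (inj₁ j) → v ≢ i → q ∉ L i (inj₁ j)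
-- Every row of c contains q at most once, and row v or row i not at all, so |c⁻¹(q)| < n.
SColor⇒∉ {n} {L = L} disjoint {q} {v} {i} {j} (c , (c∈L , proper) , size≡n) q∈Lv v≢i q∈Li =
  <-irrefl size≡n (subst (_< n) (sym (preimageSize≡ c q)) (sum-tabulate-< row≤1 (proj₁ empty-row) (proj₂ empty-row)))
  where
  same-column : ∀ {i′ j₁ j₂} → q ∈ L i′ (inj₁ j₁) → q ∈ L i′ (inj₁ j₂) → j₁ ≡ j₂
  same-column q∈₁ q∈₂ = decidable-stable (_ Fin.≟ _) (λ j₁≢j₂ → disjoint _ _ _ j₁≢j₂ q q∈₁ q∈₂)
  q∈L : ∀ {i′ j′} → c i′ j′ ≡ q → q ∈ L i′ (inj₁ j′)
  q∈L e = subst (_∈ _) e (c∈L _ _)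
  row≤1 : ∀ i′ → count≡ (c i′) q ≤ 1
  row≤1 i′ = count≡-≤1 (λ e e′ → same-column (q∈L e) (q∈L e′))
  row-empty : ∀ {i′} → q ∈ L i′ (inj₁ j) → c i′ j ≢ q → count≡ (c i′) q ≡ 0
  row-empty {i′} q∈ cⱼ≢q = count≡-none {d = c i′} λ e → cⱼ≢q (subst (λ j′ → c i′ j′ ≡ q) (same-column (q∈L e) q∈) e)
  empty-row : Σ (Fin n) λ i₀ → count≡ (c i₀) q ≡ 0
  empty-row with c v j ℕ.≟ q
  ... | yes cᵥ≡q = i , row-empty q∈Li (λ cᵢ≡q → proper v i j v≢i (trans cᵥ≡q (sym cᵢ≡q)))
  ... | no  cᵥ≢q = v , row-empty q∈Lv cᵥ≢q

IsSValue⇒≤1 : ∀ {n a b} (L : Assignment n a b) {q s} → IsSValue L q s → s ≤ 1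
IsSValue⇒≤1 _ (inj₁ (_ , refl)) = ≤-refl
IsSValue⇒≤1 _ (inj₂ (_ , refl)) = z≤n

prodTail≡ : ∀ m a → prodTail (suc (suc m)) a ≡ ((m + a) P′ m) ^ a
prodTail≡ m a = begin
  product (map (λ k → (suc (suc m) + a ∸ (k + 2)) ^ a) (upTo m))
    ≡⟨ cong product (map-cong (λ k → cong (λ t → (suc (suc m) + a ∸ t) ^ a) (+-comm k 2)) (upTo m)) ⟩
  product (map (λ k → (m + a ∸ k) ^ a) (upTo m))
    ≡⟨ cong product (map-∘ (upTo m)) ⟩
  product (map (_^ a) (map (m + a ∸_) (upTo m)))
    ≡⟨ product-map-^ a (map (m + a ∸_) (upTo m)) ⟩
  product (map (m + a ∸_) (upTo m)) ^ a
    ≡⟨ cong (_^ a) (product-upTo-∸ (m + a) m) ⟩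
  ((m + a) P′ m) ^ a
    ∎
  where open ≡-Reasoning

module Columns {m a b} (L : Assignment (suc (suc m)) a b) (isK : IsKAssignment (suc (m + a)) L)
  (disjoint : XDisjoint L) (q : Fin a → ℕ) (q∈L : ∀ j → q j ∈ L zero (inj₁ j)) where

  columnLists : Fin a → Fin (suc (suc m)) → List ℕ
  columnLists j i = L i (inj₁ j)

  -- col i is the color of (v_i, x_j).
  Column : Fin a → Pred (Fin (suc (suc m)) → ℕ) 0ℓ
  Column j col = CliqueColoring (columnLists j) [] col × col zero ≡ q j

  columns⇒InCXq : ∀ {f : Fin a → Fin (suc (suc m)) → ℕ} → (∀ j → Column j (f j)) → InCXq L zero q (λ i j → f j i)
  columns⇒InCXq cols =
    ((λ i j → ∈-lists (proj₁ (cols j)) i) , (λ i i′ j i≢i′ → i≢i′ ∘ injective (proj₁ (cols j)))) , proj₂ ∘ cols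

  private
    lower-colorings : ∀ j F →
      Witnesses (Pointwise _≡_) (CliqueColoring (V.tail (columnLists j)) F) ((suc (m + a) ∸ length F) P′ suc m)
    lower-colorings j = cliqueColorings (V.tail (columnLists j))
      (λ i → ≤-reflexive (sym (proj₁ (isK (suc i) (inj₁ j))))) (λ i → proj₂ (isK (suc i) (inj₁ j)))

    precolor : ∀ {j N} → Witnesses (Pointwise _≡_) (CliqueColoring (V.tail (columnLists j)) [ q j ]) N →
      Witnesses (Pointwise _≡_) (Column j) N
    precolor {j} = witnesses-map (q j V.∷_) (λ χ → ∷-cliqueColoring (q∈L j) (λ ()) χ , refl) (_∘ suc)

  column-witnesses : ∀ j {s} → IsSValue L (q j) s →
    Witnesses (Pointwise _≡_) (Column j) (a ^ (1 ∸ s) * suc (m + a) ^ s * ((m + a) P′ m))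
  column-witnesses j (inj₂ (_ , refl)) =
    subst (Witnesses _ _) (cong (_* ((m + a) P′ m)) a≡a¹ℓ⁰) (precolor (lower-colorings j [ q j ]))
    where
    a≡a¹ℓ⁰ : m + a ∸ m ≡ a * 1 * 1
    a≡a¹ℓ⁰ = trans (m+n∸m≡n m a) (sym (trans (*-identityʳ (a * 1)) (*-identityʳ a)))
  column-witnesses j (inj₁ (saturated , refl)) =
    subst (Witnesses _ _) (trans (P′-suc (suc (m + a)) m) (cong (_* ((m + a) P′ m)) ℓ≡a⁰ℓ¹))
      (precolor (witnesses-map id (cliqueColoring-∉-lists q∉lower) id (lower-colorings j [])))
    where
    q∉lower : ∀ i → q j ∉ columnLists j (suc i)
    q∉lower i = SColor⇒∉ {L = L} disjoint saturated (q∈L j) Fin.0≢1+n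
    ℓ≡a⁰ℓ¹ : suc (m + a) ≡ 1 * (suc (m + a) * 1)
    ℓ≡a⁰ℓ¹ = sym (trans (*-identityˡ _) (*-identityʳ _))

toAtLeast : ∀ {n a N} {P : Pred (XColoring n a) 0ℓ} → Witnesses (Pointwise (Pointwise _≡_)) P N → AtLeast N P
toAtLeast W = pick W , valid W , λ _ _ → distinct W

lemma17 : (n a : ℕ) (h2n : 2 ≤ n) → n ≤ a →
    (L : Assignment n a (bVal n a)) →
    IsKAssignment (n + a ∸ 1) L → XDisjoint L →
    (q : Fin a → ℕ) → (∀ (j : Fin a) → q j ∈ L (v₁ h2n) (inj₁ j)) →
    (σ : Fin a → ℕ) → (∀ (j : Fin a) → IsSValue L (q j) (σ j)) →
    AtLeast (a ^ (a ∸ sumFin a σ) * (n + a ∸ 1) ^ sumFin a σ * prodTail n a)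
            (InCXq L (v₁ h2n) q)
lemma17 (suc (suc m)) a _ _ L isK disjoint q q∈L σ σ-spec =
  toAtLeast (subst (Witnesses _ _) total
    (witnesses-map {Q = InCXq L zero q} (λ f i j → f j i) columns⇒InCXq (λ e j i → e i j)
      (witnesses-Π (λ j → column-witnesses j (σ-spec j)))))
  where
  open Columns L isK disjoint q q∈L
  total : product (tabulate (λ j → a ^ (1 ∸ σ j) * suc (m + a) ^ σ j * ((m + a) P′ m)))
        ≡ a ^ (a ∸ sumFin a σ) * suc (m + a) ^ sumFin a σ * prodTail (suc (suc m)) a
  total rewrite sumFin≡sum-tabulate a σ | prodTail≡ m a =
    product-tabulate-powers a (suc (m + a)) ((m + a) P′ m) (IsSValue⇒≤1 L ∘ σ-spec)
lemma17 (suc zero) _ (s≤s ()) _ _ _ _ _ _ _ _
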